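{- Let $w$ be a word over a finite alphabet and let $1 \le i \le |w|/2$ be an integer. Then $w$ has a border of length $i$ if and only if $f(w)$ has an even palindromic prefix of order $i$, i.e., the prefix of $f(w)$ of length $2i$ is a palindrome.
   Context: For words $x = a_1\cdots a_n$, $y = b_1\cdots b_n$ of equal length, the perfect shuffle is $x \,\text{ш}\, y = a_1 b_1 a_2 b_2\cdots a_n b_n$. $w^R$ denotes the reverse of $w$; a palindrome is a word equal to its reverse, and a palindrome of length $n$ has order $\lfloor n/2\rfloor$. The map $f$ on words is defined by $f(x) = (y \,\text{ш}\, z^R)\,a$ where $x = yaz$ with $|y|=|z|$ and $a$ is empty if $|x|$ is even and a single letter if $|x|$ is odd. A border of $w$ is a word $u$ with $0<|u|<|w|$ that is both a prefix and a suffix of $w$. -}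

module Defs where

open import Data.Nat using (ℕ; zero; suc; _∸_; _<_; _/_)
open import Data.List using (List; []; _∷_; _++_; take; drop; length; reverse)
open import Data.Product using (_×_)
open import Relation.Binary.PropositionalEquality using (_≡_)

-- perfect shuffle a₁b₁a₂b₂…; intended for equal-length arguments
-- (on unequal lengths it truncates; f only uses it on equal lengths)
shuffle : {A : Set} → List A → List A → List A
shuffle (a ∷ as) (b ∷ bs) = a ∷ b ∷ shuffle as bs
shuffle _ _ = []

-- x = y a z with |y| = |z| = ⌊|x|/2⌋, a the (possibly empty) middle
half : {A : Set} → List A → ℕ
half x = length x / 2

leftPart : {A : Set} → List A → List A
leftPart x = take (half x) x

middle : {A : Set} → List A → List A
middle x = take (length x ∸ (half x + half x)) (drop (half x) x)
  where open Data.Nat using (_+_)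

rightPart : {A : Set} → List A → List A
rightPart x = drop (length x ∸ half x) x

f : {A : Set} → List A → List A
f x = shuffle (leftPart x) (reverse (rightPart x)) ++ middle x

IsPalindrome : {A : Set} → List A → Set
IsPalindrome u = reverse u ≡ u

HasBorderOfLength : {A : Set} → List A → ℕ → Set
HasBorderOfLength w i =
  0 < i × i < length w × take i w ≡ drop (length w ∸ i) w

-- Reading f(w) two letters at a time, its prefix of length 2i is the perfect shuffle
-- u ш v^R of the prefix u and the suffix v of w of length i.  Reversing a shuffle of
-- equal-length words swaps and reverses its arguments, (u ш v^R)^R = v ш u^R, and a
-- shuffle determines its arguments; so that prefix is a palindrome iff u = v, i.e. iff
-- w has a border of length i.
module Submission where

open import Defs
open import Data.Nat using (ℕ; _≤_; _/_; _+_)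
open import Data.Fin using (Fin)
open import Data.List using (List; take; length)
open import Function.Bundles using (_⇔_)

open import Data.Nat using (zero; suc; _∸_; _<_; z≤n; s≤s)
open import Data.Nat.Properties
open import Data.Nat.DivMod using (m/n≤m; m/n<m)
open import Data.List using ([]; _∷_; _++_; [_]; drop; reverse)
open import Data.List.Properties
open import Data.Product using (_×_; _,_; proj₁)
open import Function.Bundles using (mk⇔; Equivalence)
open import Relation.Binary.PropositionalEquality hiding ([_])
open ≡-Reasoning

m∸n+[n∸o]≡m∸o : ∀ {m n o} → o ≤ n → n ≤ m → (m ∸ n) + (n ∸ o) ≡ m ∸ o
m∸n+[n∸o]≡m∸o {m} {n} {o} o≤n n≤m = begin
  (m ∸ n) + (n ∸ o)  ≡⟨ +-∸-assoc (m ∸ n) o≤n ⟨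
  (m ∸ n) + n ∸ o    ≡⟨ cong (_∸ o) (m∸n+n≡m n≤m) ⟩
  m ∸ o              ∎

≤half⇒<length : ∀ {i n} → 1 ≤ i → i ≤ n / 2 → i < n
≤half⇒<length {n = zero}  (s≤s _) ()
≤half⇒<length {n = suc n} _   i≤h = ≤-<-trans i≤h (m/n<m (suc n) 2 (s≤s (s≤s z≤n)))

module _ {A : Set} where

  suffix : ℕ → List A → List A
  suffix i xs = drop (length xs ∸ i) xs

  length-suffix : ∀ {i} (xs : List A) → i ≤ length xs → length (suffix i xs) ≡ i
  length-suffix {i} xs i≤n = trans (length-drop (length xs ∸ i) xs) (m∸[m∸n]≡n i≤n)

  length-take-≤ : ∀ {i} (xs : List A) → i ≤ length xs → length (take i xs) ≡ i
  length-take-≤ {i} xs i≤n = trans (length-take i xs) (m≤n⇒m⊓n≡m i≤n)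

  take-take-≤ : ∀ {i j} (xs : List A) → i ≤ j → take i (take j xs) ≡ take i xs
  take-take-≤ {i} {j} xs i≤j = trans (take-take i j xs) (cong (λ k → take k xs) (m≤n⇒m⊓n≡m i≤j))

  suffix-suffix : ∀ {i j} (xs : List A) → i ≤ j → j ≤ length xs →
    suffix i (suffix j xs) ≡ suffix i xs
  suffix-suffix {i} {j} xs i≤j j≤n = begin
    drop (length (suffix j xs) ∸ i) (suffix j xs)  ≡⟨ cong (λ k → drop (k ∸ i) (suffix j xs)) (length-suffix xs j≤n) ⟩
    drop (j ∸ i) (drop (length xs ∸ j) xs)         ≡⟨ drop-drop (length xs ∸ j) (j ∸ i) xs ⟩
    drop ((length xs ∸ j) + (j ∸ i)) xs            ≡⟨ cong (λ k → drop k xs) (m∸n+[n∸o]≡m∸o i≤j j≤n) ⟩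
    suffix i xs                                    ∎

  take-length-++ : ∀ (xs ys : List A) → take (length xs) (xs ++ ys) ≡ xs
  take-length-++ []       ys = refl
  take-length-++ (x ∷ xs) ys = cong (x ∷_) (take-length-++ xs ys)

  take-reverse : ∀ {i} (xs : List A) → i ≤ length xs → take i (reverse xs) ≡ reverse (suffix i xs)
  take-reverse {i} xs i≤n = begin
    take i (reverse xs)
      ≡⟨ cong (λ ys → take i (reverse ys)) (take++drop≡id k xs) ⟨
    take i (reverse (take k xs ++ drop k xs))
      ≡⟨ cong (take i) (reverse-++ (take k xs) (drop k xs)) ⟩
    take i (reverse (drop k xs) ++ reverse (take k xs))
      ≡⟨ cong (λ l → take l (reverse (drop k xs) ++ reverse (take k xs))) length-reversed-suffix ⟨
    take (length (reverse (drop k xs))) (reverse (drop k xs) ++ reverse (take k xs))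
      ≡⟨ take-length-++ (reverse (drop k xs)) (reverse (take k xs)) ⟩
    reverse (drop k xs)
      ∎
    where
      k = length xs ∸ i
      length-reversed-suffix : length (reverse (drop k xs)) ≡ i
      length-reversed-suffix = trans (length-reverse (drop k xs)) (length-suffix xs i≤n)

  take-shuffle-++ : ∀ i (xs ys zs : List A) → i ≤ length xs → i ≤ length ys →
    take (i + i) (shuffle xs ys ++ zs) ≡ shuffle (take i xs) (take i ys)
  take-shuffle-++ zero    xs       ys       zs _         _         = refl
  take-shuffle-++ (suc i) (x ∷ xs) (y ∷ ys) zs (s≤s i≤m) (s≤s i≤n)
    rewrite +-suc i i = cong (λ t → x ∷ y ∷ t) (take-shuffle-++ i xs ys zs i≤m i≤n)

  shuffle-∷ʳ : ∀ (xs ys : List A) x y → length xs ≡ length ys →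
    shuffle (xs ++ [ x ]) (ys ++ [ y ]) ≡ shuffle xs ys ++ x ∷ y ∷ []
  shuffle-∷ʳ []       []       x y _ = refl
  shuffle-∷ʳ (a ∷ xs) (b ∷ ys) x y e = cong (λ t → a ∷ b ∷ t) (shuffle-∷ʳ xs ys x y (suc-injective e))

  reverse-shuffle : ∀ (xs ys : List A) → length xs ≡ length ys →
    reverse (shuffle xs ys) ≡ shuffle (reverse ys) (reverse xs)
  reverse-shuffle []       []       _ = refl
  reverse-shuffle (x ∷ xs) (y ∷ ys) e = begin
    reverse (x ∷ y ∷ shuffle xs ys)
      ≡⟨ reverse-++ (x ∷ y ∷ []) (shuffle xs ys) ⟩
    reverse (shuffle xs ys) ++ y ∷ x ∷ []
      ≡⟨ cong (_++ y ∷ x ∷ []) (reverse-shuffle xs ys e′) ⟩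
    shuffle (reverse ys) (reverse xs) ++ y ∷ x ∷ []
      ≡⟨ shuffle-∷ʳ (reverse ys) (reverse xs) y x reversed-lengths ⟨
    shuffle (reverse ys ++ [ y ]) (reverse xs ++ [ x ])
      ≡⟨ cong₂ shuffle (unfold-reverse y ys) (unfold-reverse x xs) ⟨
    shuffle (reverse (y ∷ ys)) (reverse (x ∷ xs))
      ∎
    where
      e′ = suc-injective e
      reversed-lengths : length (reverse ys) ≡ length (reverse xs)
      reversed-lengths = trans (length-reverse ys) (trans (sym e′) (sym (length-reverse xs)))

  shuffle-injective : ∀ (xs ys xs′ ys′ : List A) → length xs ≡ length ys → length xs′ ≡ length ys′ →
    shuffle xs ys ≡ shuffle xs′ ys′ → xs ≡ xs′ × ys ≡ ys′
  shuffle-injective []       []       []         []         _ _ _  = refl , refl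
  shuffle-injective []       []       (_ ∷ _)    (_ ∷ _)    _ _ ()
  shuffle-injective (_ ∷ _)  (_ ∷ _)  []         []         _ _ ()
  shuffle-injective (x ∷ xs) (y ∷ ys) (x′ ∷ xs′) (y′ ∷ ys′) e e′ eq
    with shuffle-injective xs ys xs′ ys′ (suc-injective e) (suc-injective e′) (∷-injectiveʳ (∷-injectiveʳ eq))
  ... | xs≡xs′ , ys≡ys′ = cong₂ _∷_ (∷-injectiveˡ eq) xs≡xs′ , cong₂ _∷_ (∷-injectiveˡ (∷-injectiveʳ eq)) ys≡ys′

  palindrome-shuffle-reverse⇔ : ∀ (xs ys : List A) → length xs ≡ length ys →
    IsPalindrome (shuffle xs (reverse ys)) ⇔ xs ≡ ys
  palindrome-shuffle-reverse⇔ xs ys e = mk⇔ to from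
    where
      e-rev : length xs ≡ length (reverse ys)
      e-rev = trans e (sym (length-reverse ys))

      reversal : reverse (shuffle xs (reverse ys)) ≡ shuffle ys (reverse xs)
      reversal = trans (reverse-shuffle xs (reverse ys) e-rev)
                       (cong (λ zs → shuffle zs (reverse xs)) (reverse-involutive ys))

      to : IsPalindrome (shuffle xs (reverse ys)) → xs ≡ ys
      to pal = sym (proj₁ (shuffle-injective ys (reverse xs) xs (reverse ys)
                 (trans (sym e) (sym (length-reverse xs))) e-rev (trans (sym reversal) pal)))

      from : xs ≡ ys → IsPalindrome (shuffle xs (reverse ys))
      from refl = reversal

  take-f : ∀ {i} (w : List A) → i ≤ half w →
    take (i + i) (f w) ≡ shuffle (take i w) (reverse (suffix i w))
  take-f {i} w i≤h = begin
    take (i + i) (shuffle (leftPart w) (reverse (rightPart w)) ++ middle w)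
      ≡⟨ take-shuffle-++ i (leftPart w) (reverse (rightPart w)) (middle w)
           (subst (i ≤_) (sym (length-take-≤ w h≤n)) i≤h)
           (subst (i ≤_) (sym (trans (length-reverse (rightPart w)) (length-suffix w h≤n))) i≤h) ⟩
    shuffle (take i (take (half w) w)) (take i (reverse (suffix (half w) w)))
      ≡⟨ cong₂ shuffle (take-take-≤ w i≤h) (take-reverse (suffix (half w) w) (subst (i ≤_) (sym (length-suffix w h≤n)) i≤h)) ⟩
    shuffle (take i w) (reverse (suffix i (suffix (half w) w)))
      ≡⟨ cong (λ zs → shuffle (take i w) (reverse zs)) (suffix-suffix w i≤h h≤n) ⟩
    shuffle (take i w) (reverse (suffix i w))
      ∎
    where
      h≤n : half w ≤ length w
      h≤n = m/n≤m (length w) 2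

theorem2 : (k : ℕ) (w : List (Fin k)) (i : ℕ) → 1 ≤ i → i ≤ length w / 2 →
    (HasBorderOfLength w i ⇔ IsPalindrome (take (i + i) (f w)))
theorem2 k w i 1≤i i≤h = mk⇔
  (λ (_ , _ , border) → subst IsPalindrome (sym prefix) (from palindrome⇔ border))
  (λ pal → 1≤i , i<n , to palindrome⇔ (subst IsPalindrome prefix pal))
  where
    open Equivalence
    i<n = ≤half⇒<length 1≤i i≤h
    i≤n = <⇒≤ i<n
    prefix = take-f w i≤h
    palindrome⇔ = palindrome-shuffle-reverse⇔ (take i w) (suffix i w)
                    (trans (length-take-≤ w i≤n) (sym (length-suffix w i≤n)))
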